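{- Let $n$ be a positive integer, $m=\binom{n}{2}$, $M=\lceil m/2\rceil$, and let $\mathcal{G}^{(j)}$ be the set of connected graphs on vertex set $[n]$ with exactly $j$ edges. For every $k=n-1,\dots,M-1$ there is a complete matching from $\mathcal{G}^{(k)}$ to $\mathcal{G}^{(k+1)}$.
   Context: Graphs are simple. A complete matching from $\mathcal{G}^{(k)}$ to $\mathcal{G}^{(l)}$ is an injection $f:\mathcal{G}^{(k)}\to\mathcal{G}^{(l)}$ such that $G$ and $f(G)$ are comparable (one edge set contains the other) for every $G\in\mathcal{G}^{(k)}$. -}

module Defs where

open import Data.Nat using (ℕ; zero; suc; _<ᵇ_)
open import Data.Bool using (Bool; true; false; _∧_; if_then_else_)
open import Data.Fin using (Fin; toℕ)
open import Data.Vec using (Vec; lookup)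
open import Data.List using (List; map; allFin)
open import Data.Nat.ListAction using (sum)
open import Data.Product using (_×_)
open import Data.Sum using (_⊎_)
open import Relation.Binary.PropositionalEquality using (_≡_)

-- Representing graphs by Vec-matrices makes propositional
-- equality coincide with equality of edge sets (for simple matrices).
Mat : ℕ → Set
Mat n = Vec (Vec Bool n) n

adj : ∀ {n} → Mat n → Fin n → Fin n → Bool
adj A i j = lookup (lookup A i) j

IsSimple : ∀ {n} → Mat n → Set
IsSimple {n} A = (∀ (i j : Fin n) → adj A i j ≡ adj A j i) × (∀ (i : Fin n) → adj A i i ≡ false)

edgeCount : ∀ {n} → Mat n → ℕ
edgeCount {n} A =
  sum (map (λ i → sum (map (λ j → if (toℕ i <ᵇ toℕ j) ∧ adj A i j then 1 else 0) (allFin n))) (allFin n))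

data Reachable {n : ℕ} (A : Mat n) : Fin n → Fin n → Set where
  here : ∀ {u} → Reachable A u u
  step : ∀ {u w v} → adj A u w ≡ true → Reachable A w v → Reachable A u v

Connected : ∀ {n} → Mat n → Set
Connected {n} A = ∀ (u v : Fin n) → Reachable A u v

InG : (n j : ℕ) → Mat n → Set
InG n j A = IsSimple A × Connected A × (edgeCount A ≡ j)

Sub : ∀ {n} → Mat n → Mat n → Set
Sub {n} G H = ∀ (i j : Fin n) → adj G i j ≡ true → adj H i j ≡ true

Comparable : ∀ {n} → Mat n → Mat n → Set
Comparable G H = Sub G H ⊎ Sub H G

record CompleteMatching (n k l : ℕ) : Set where
  field
    f        : Mat n → Mat n
    maps-to  : ∀ G → InG n k G → InG n l (f G)
    injOn    : ∀ G H → InG n k G → InG n k H → f G ≡ f H → G ≡ H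
    compar   : ∀ G → InG n k G → Comparable G (f G)

module Submission where

-- A simple graph on [n] is determined by its edge indicator
-- string over the m = n C 2 pairs i < j; its number of ones is the number
-- of edges.  Below the middle of the Boolean lattice the bracket
-- (Greene–Kleitman) matching applies: read 0 as "(" and 1 as ")", and turn
-- the first unmatched "(" into ")".  This adds exactly one 1, it is
-- undone by reopening the last unmatched ")" (so it is injective), and an
-- unmatched "(" exists whenever there are fewer ones than zeros.
-- On graphs the map adds one edge: the image is a supergraph, hence
-- comparable and still connected.

open import Defs
open import Data.Nat using (ℕ; zero; suc; _+_; _≤_; _<_; _∸_; _<ᵇ_; z≤n; s≤s; ⌈_/2⌉)
open import Data.Nat.Properties
  using (≤-refl; ≤-trans; +-suc; <ᵇ⇒<; <⇒<ᵇ; <-irrefl; <-cmp; <⇒≱; n≤1+n; +-monoʳ-≤; <-asym; +-cancelˡ-<)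
open import Data.Nat.Combinatorics using (_C_; nCk+nC[k+1]≡[n+1]C[k+1]; nC1≡n)
open import Data.Bool using (Bool; true; false; _∧_; _∨_; if_then_else_; T)
open import Data.Bool.Properties using (∧-comm; ∨-comm; ∨-zeroʳ; ∨-identityʳ; ∧-identityʳ)
open import Relation.Nullary.Decidable using (T?)
open import Data.Fin as F using (Fin; toℕ)
open import Data.Fin.Properties using (toℕ-injective)
open import Data.Vec using (Vec; lookup; tabulate)
open import Data.Vec.Properties using (lookup∘tabulate; tabulate∘lookup; tabulate-cong)
open import Data.List using (List; []; _∷_; map; allFin; filter; cartesianProduct; _++_; length)
open import Data.List.Properties using (map-cong; length-map; map-tabulate; map-++; map-∘; ∷-injective)
open import Data.Nat.ListAction using (sum)
open import Data.Nat.ListAction.Properties using (sum-++)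
open import Data.Product using (_×_; _,_; proj₁; proj₂)
open import Data.Sum using (_⊎_; inj₁; inj₂)
open import Data.Empty using (⊥-elim)
open import Relation.Nullary using (¬_; Dec; yes; no; does)
open import Relation.Binary.Definitions using (tri<; tri≈; tri>)
open import Relation.Binary.PropositionalEquality
open import Data.List.Relation.Unary.Unique.Propositional using (Unique)
import Data.List.Relation.Unary.Unique.Propositional.Properties as Unique
open import Data.List.Relation.Unary.AllPairs using (AllPairs)
open import Data.List.Membership.Propositional using (_∈_)
import Data.List.Membership.Propositional.Properties as Membership
import Data.List.Relation.Unary.Any as Any
import Data.List.Relation.Unary.All as All
open import Function using (_∘_)

-- (1) The bracket matching on bit strings

-- A bit string is read as a bracket word: false = "(" and true = ")".
-- depthStep h b is the number of open brackets after reading b at depth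
-- h; a ")" read at depth 0 is unmatched and leaves the depth at 0.
depthStep : ℕ → Bool → ℕ
depthStep h false = suc h
depthStep zero true = zero
depthStep (suc h) true = h

isPositive : ℕ → Bool
isPositive zero = false
isPositive (suc _) = true

-- The depth stays positive after every prefix of s (started at depth h):
-- an "(" read just before s at depth 0 is then never matched.
staysPositive : ℕ → List Bool → Bool
staysPositive h [] = true
staysPositive h (b ∷ s) = isPositive (depthStep h b) ∧ staysPositive (depthStep h b) s

noFreeClose : ℕ → List Bool → Bool
noFreeClose h [] = true
noFreeClose zero (true ∷ s) = false
noFreeClose zero (false ∷ s) = noFreeClose 1 s
noFreeClose (suc h) (b ∷ s) = noFreeClose (depthStep (suc h) b) s

hasFreeOpen : ℕ → List Bool → Bool
hasFreeOpen h [] = false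
hasFreeOpen zero (false ∷ s) = if staysPositive 1 s then true else hasFreeOpen 1 s
hasFreeOpen zero (true ∷ s) = hasFreeOpen zero s
hasFreeOpen (suc h) (b ∷ s) = hasFreeOpen (depthStep (suc h) b) s

firstFreeOpen : ℕ → List Bool → ℕ
firstFreeOpen h [] = 0
firstFreeOpen zero (false ∷ s) = if staysPositive 1 s then 0 else suc (firstFreeOpen 1 s)
firstFreeOpen zero (true ∷ s) = suc (firstFreeOpen zero s)
firstFreeOpen (suc h) (b ∷ s) = suc (firstFreeOpen (depthStep (suc h) b) s)

setAt : List Bool → ℕ → List Bool
setAt [] _ = []
setAt (b ∷ s) zero = true ∷ s
setAt (b ∷ s) (suc i) = b ∷ setAt s i

-- The inverse of the matching: turn the last unmatched ")" back into "(".
reopenLastFreeClose : ℕ → List Bool → List Bool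
reopenLastFreeClose h [] = []
reopenLastFreeClose zero (true ∷ s) =
  if noFreeClose zero s then false ∷ s else true ∷ reopenLastFreeClose zero s
reopenLastFreeClose zero (false ∷ s) = false ∷ reopenLastFreeClose 1 s
reopenLastFreeClose (suc h) (b ∷ s) = b ∷ reopenLastFreeClose (depthStep (suc h) b) s

ones : List Bool → ℕ
ones [] = 0
ones (b ∷ s) = (if b then 1 else 0) + ones s

zeros : List Bool → ℕ
zeros [] = 0
zeros (b ∷ s) = (if b then 0 else 1) + zeros s

ones+zeros≡length : ∀ s → ones s + zeros s ≡ length s
ones+zeros≡length [] = refl
ones+zeros≡length (true ∷ s) = cong suc (ones+zeros≡length s)
ones+zeros≡length (false ∷ s) = trans (+-suc (ones s) (zeros s)) (cong suc (ones+zeros≡length s))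

-- Behind an unmatched "(" the depth never returns to its level, so no
-- unmatched ")" can follow it.
staysPositive⇒noFreeClose : ∀ h s → staysPositive (suc h) s ≡ true → noFreeClose h s ≡ true
staysPositive⇒noFreeClose h [] _ = refl
staysPositive⇒noFreeClose zero (false ∷ s) p = staysPositive⇒noFreeClose 1 s p
staysPositive⇒noFreeClose (suc h) (false ∷ s) p = staysPositive⇒noFreeClose (suc (suc h)) s p
staysPositive⇒noFreeClose zero (true ∷ s) ()
staysPositive⇒noFreeClose (suc h) (true ∷ s) p = staysPositive⇒noFreeClose h s p

flip-createsFreeClose : ∀ h s → hasFreeOpen h s ≡ true →
  noFreeClose h (setAt s (firstFreeOpen h s)) ≡ false
flip-createsFreeClose h [] ()
flip-createsFreeClose zero (false ∷ s) p with staysPositive 1 s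
... | true = refl
... | false = flip-createsFreeClose 1 s p
flip-createsFreeClose zero (true ∷ s) p = refl
flip-createsFreeClose (suc h) (b ∷ s) p = flip-createsFreeClose (depthStep (suc h) b) s p

reopen-flip : ∀ h s → hasFreeOpen h s ≡ true →
  reopenLastFreeClose h (setAt s (firstFreeOpen h s)) ≡ s
reopen-flip h [] ()
reopen-flip zero (false ∷ s) p with staysPositive 1 s in eq
... | true rewrite staysPositive⇒noFreeClose 0 s eq = refl
... | false = cong (false ∷_) (reopen-flip 1 s p)
reopen-flip zero (true ∷ s) p rewrite flip-createsFreeClose zero s p =
  cong (true ∷_) (reopen-flip zero s p)
reopen-flip (suc h) (b ∷ s) p = cong (b ∷_) (reopen-flip (depthStep (suc h) b) s p)

ones-flip : ∀ h s → hasFreeOpen h s ≡ true → ones (setAt s (firstFreeOpen h s)) ≡ suc (ones s)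
ones-flip h [] ()
ones-flip zero (false ∷ s) p with staysPositive 1 s
... | true = refl
... | false = ones-flip 1 s p
ones-flip zero (true ∷ s) p = cong suc (ones-flip zero s p)
ones-flip (suc h) (false ∷ s) p = ones-flip _ s p
ones-flip (suc h) (true ∷ s) p = cong suc (ones-flip _ s p)

firstFreeOpen<length : ∀ h s → hasFreeOpen h s ≡ true → firstFreeOpen h s < length s
firstFreeOpen<length h [] ()
firstFreeOpen<length zero (false ∷ s) p with staysPositive 1 s
... | true = s≤s z≤n
... | false = s≤s (firstFreeOpen<length 1 s p)
firstFreeOpen<length zero (true ∷ s) p = s≤s (firstFreeOpen<length zero s p)
firstFreeOpen<length (suc h) (b ∷ s) p = s≤s (firstFreeOpen<length _ s p)

true≢false : true ≢ false
true≢false ()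

finalDepth : ℕ → List Bool → ℕ
finalDepth h [] = h
finalDepth h (b ∷ s) = finalDepth (depthStep h b) s

-- Without an unmatched "(", either every bracket opened is closed again
-- (final depth 0), or we started inside an unmatched "(".
noFreeOpen⇒balanced : ∀ h s → hasFreeOpen h s ≡ false →
  finalDepth h s ≡ 0 ⊎ (isPositive h ≡ true × staysPositive h s ≡ true)
noFreeOpen⇒balanced zero [] _ = inj₁ refl
noFreeOpen⇒balanced (suc h) [] _ = inj₂ (refl , refl)
noFreeOpen⇒balanced zero (false ∷ s) p with staysPositive 1 s in eq
... | true = ⊥-elim (true≢false p)
... | false with noFreeOpen⇒balanced 1 s p
...   | inj₁ q = inj₁ q
...   | inj₂ (_ , q) = ⊥-elim (true≢false (trans (sym q) eq))
noFreeOpen⇒balanced zero (true ∷ s) p with noFreeOpen⇒balanced zero s p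
... | inj₁ q = inj₁ q
... | inj₂ (() , _)
noFreeOpen⇒balanced (suc h) (b ∷ s) p with noFreeOpen⇒balanced (depthStep (suc h) b) s p
... | inj₁ q = inj₁ q
... | inj₂ (q₁ , q₂) = inj₂ (refl , cong₂ _∧_ q₁ q₂)

-- Every "(" raises the depth and each ")" lowers it by at most one.
zeros≤finalDepth : ∀ h s → h + zeros s ≤ finalDepth h s + ones s
zeros≤finalDepth h [] = ≤-refl
zeros≤finalDepth h (false ∷ s) =
  subst (_≤ finalDepth (suc h) s + ones s) (sym (+-suc h (zeros s))) (zeros≤finalDepth (suc h) s)
zeros≤finalDepth zero (true ∷ s) =
  ≤-trans (zeros≤finalDepth zero s) (+-monoʳ-≤ (finalDepth zero s) (n≤1+n _))
zeros≤finalDepth (suc h) (true ∷ s) =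
  subst (suc h + zeros s ≤_) (sym (+-suc (finalDepth h s) (ones s))) (s≤s (zeros≤finalDepth h s))

hasFreeOpen-belowMiddle : ∀ s → ones s < zeros s → hasFreeOpen 0 s ≡ true
hasFreeOpen-belowMiddle s lt with hasFreeOpen 0 s in eq
... | true = refl
... | false with noFreeOpen⇒balanced 0 s eq
...   | inj₂ (() , _)
...   | inj₁ q = ⊥-elim (<⇒≱ lt (subst (λ x → zeros s ≤ x + ones s) q (zeros≤finalDepth 0 s)))

-- (2) Lists, and graphs as bit strings

nthOr : ∀ {A : Set} → List A → ℕ → A → A
nthOr [] _ d = d
nthOr (x ∷ xs) zero d = x
nthOr (x ∷ xs) (suc t) d = nthOr xs t d

nthOr∈ : ∀ {A : Set} (xs : List A) t d → t < length xs → nthOr xs t d ∈ xs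
nthOr∈ (x ∷ xs) zero d _ = Any.here refl
nthOr∈ (x ∷ xs) (suc t) d (s≤s lt) = Any.there (nthOr∈ xs t d lt)

map-cong-∈ : ∀ {A : Set} (f g : A → Bool) (xs : List A) → (∀ q → q ∈ xs → g q ≡ f q) → map g xs ≡ map f xs
map-cong-∈ f g [] h = refl
map-cong-∈ f g (x ∷ xs) h = cong₂ _∷_ (h x (Any.here refl)) (map-cong-∈ f g xs (λ q q∈ → h q (Any.there q∈)))

map-setAt : ∀ {A : Set} (f g : A → Bool) (xs : List A) (t : ℕ) (d : A) → Unique xs → t < length xs →
  (∀ q → q ∈ xs → q ≢ nthOr xs t d → g q ≡ f q) → g (nthOr xs t d) ≡ true →
  map g xs ≡ setAt (map f xs) t
map-setAt f g (x ∷ xs) zero d (px AllPairs.∷ u) lt off on =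
  cong₂ _∷_ on (map-cong-∈ f g xs (λ q q∈ → off q (Any.there q∈) (λ eq → All.lookup px q∈ (sym eq))))
map-setAt f g (x ∷ xs) (suc t) d (px AllPairs.∷ u) (s≤s lt) off on =
  cong₂ _∷_ (off x (Any.here refl) (λ eq → All.lookup px (nthOr∈ xs t d lt) eq))
            (map-setAt f g xs t d u lt (λ q q∈ → off q (Any.there q∈)) on)

map-agree : ∀ {A : Set} (f g : A → Bool) (xs : List A) {x} → map f xs ≡ map g xs → x ∈ xs → f x ≡ g x
map-agree f g (y ∷ xs) eq (Any.here refl) = proj₁ (∷-injective eq)
map-agree f g (y ∷ xs) eq (Any.there x∈) = map-agree f g xs (proj₂ (∷-injective eq)) x∈

Pair : ℕ → Set
Pair n = Fin n × Fin n

isUpper : ∀ {n} → Pair n → Bool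
isUpper q = toℕ (proj₁ q) <ᵇ toℕ (proj₂ q)

isUpper? : ∀ {n} (q : Pair n) → Dec (T (isUpper q))
isUpper? q = T? (isUpper q)

upperPairs : ∀ n → List (Pair n)
upperPairs n = filter isUpper? (cartesianProduct (allFin n) (allFin n))

upperPairs-unique : ∀ n → Unique (upperPairs n)
upperPairs-unique n = Unique.filter⁺ isUpper? {cartesianProduct (allFin n) (allFin n)}
  (Unique.cartesianProduct⁺ (Unique.allFin⁺ n) (Unique.allFin⁺ n))

upperPairs-upper : ∀ n {q} → q ∈ upperPairs n → toℕ (proj₁ q) < toℕ (proj₂ q)
upperPairs-upper n q∈ =
  <ᵇ⇒< _ _ (proj₂ (Membership.∈-filter⁻ isUpper? {xs = cartesianProduct (allFin n) (allFin n)} q∈))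

upperPairs-complete : ∀ n (i j : Fin n) → toℕ i < toℕ j → (i , j) ∈ upperPairs n
upperPairs-complete n i j lt =
  Membership.∈-filter⁺ isUpper? (Membership.∈-cartesianProduct⁺ (Membership.∈-allFin i) (Membership.∈-allFin j)) (<⇒<ᵇ lt)

indicator : Bool → ℕ
indicator b = if b then 1 else 0

ones-filterUpper : ∀ {n} (g : Pair n → Bool) zs →
  ones (map g (filter isUpper? zs)) ≡ sum (map (λ q → indicator (isUpper q ∧ g q)) zs)
ones-filterUpper g [] = refl
ones-filterUpper g ((i , j) ∷ zs) with toℕ i <ᵇ toℕ j
... | true = cong (indicator (g (i , j)) +_) (ones-filterUpper g zs)
... | false = ones-filterUpper g zs

sum-cartesianProduct : ∀ {A B : Set} (h : A × B → ℕ) xs ys →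
  sum (map h (cartesianProduct xs ys)) ≡ sum (map (λ i → sum (map (λ j → h (i , j)) ys)) xs)
sum-cartesianProduct h [] ys = refl
sum-cartesianProduct h (x ∷ xs) ys = begin
    sum (map h (map (x ,_) ys ++ cartesianProduct xs ys))
  ≡⟨ cong sum (map-++ h (map (x ,_) ys) _) ⟩
    sum (map h (map (x ,_) ys) ++ map h (cartesianProduct xs ys))
  ≡⟨ sum-++ (map h (map (x ,_) ys)) _ ⟩
    sum (map h (map (x ,_) ys)) + sum (map h (cartesianProduct xs ys))
  ≡⟨ cong₂ _+_ (cong sum (sym (map-∘ ys))) (sum-cartesianProduct h xs ys) ⟩
    sum (map (λ j → h (x , j)) ys) + sum (map (λ i → sum (map (λ j → h (i , j)) ys)) xs)
  ∎
  where open ≡-Reasoning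

-- Counting the ones of a bit string over the upper pairs as a double sum,
-- the shape in which edgeCount is defined.
ones-upperPairs : ∀ {n} (g : Pair n → Bool) →
  ones (map g (upperPairs n)) ≡
  sum (map (λ i → sum (map (λ j → indicator (isUpper (i , j) ∧ g (i , j))) (allFin n))) (allFin n))
ones-upperPairs {n} g = trans (ones-filterUpper g (cartesianProduct (allFin n) (allFin n)))
  (sum-cartesianProduct (λ q → indicator (isUpper q ∧ g q)) (allFin n) (allFin n))

ones-allTrue : ∀ {A : Set} (xs : List A) → ones (map (λ _ → true) xs) ≡ length xs
ones-allTrue [] = refl
ones-allTrue (x ∷ xs) = cong suc (ones-allTrue xs)

sum-allFin-suc : ∀ {n} (f : Fin (suc n) → ℕ) →
  sum (map f (allFin (suc n))) ≡ f F.zero + sum (map (f ∘ F.suc) (allFin n))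
sum-allFin-suc {n} f =
  cong (f F.zero +_) (cong sum (trans (map-tabulate F.suc f) (sym (map-tabulate (λ x → x) (f ∘ F.suc)))))

sum-allFin-one : ∀ n → sum (map (λ (_ : Fin n) → 1) (allFin n)) ≡ n
sum-allFin-one zero = refl
sum-allFin-one (suc n) = trans (sum-allFin-suc {n} (λ _ → 1)) (cong suc (sum-allFin-one n))

upperCount : ℕ → ℕ
upperCount n = sum (map (λ (i : Fin n) → sum (map (λ (j : Fin n) → indicator (toℕ i <ᵇ toℕ j)) (allFin n))) (allFin n))

-- Splitting off the vertex 0, which lies below the other n vertices.
upperCount-suc : ∀ n → upperCount (suc n) ≡ n + upperCount n
upperCount-suc n = trans (sum-allFin-suc {n} row)
  (cong₂ _+_ (trans (sum-allFin-suc {n} (λ j → indicator (0 <ᵇ toℕ j))) (sum-allFin-one n))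
             (cong sum (map-cong (λ i → sum-allFin-suc {n} (λ j → indicator (suc (toℕ i) <ᵇ toℕ j))) (allFin n))))
  where
  row : Fin (suc n) → ℕ
  row i = sum (map (λ (j : Fin (suc n)) → indicator (toℕ i <ᵇ toℕ j)) (allFin (suc n)))

upperCount≡C2 : ∀ n → upperCount n ≡ n C 2
upperCount≡C2 zero = refl
upperCount≡C2 (suc n) = trans (upperCount-suc n)
  (trans (cong₂ _+_ (sym (nC1≡n n)) (upperCount≡C2 n)) (nCk+nC[k+1]≡[n+1]C[k+1] n 1))

length-upperPairs : ∀ n → length (upperPairs n) ≡ n C 2
length-upperPairs n = trans (sym (ones-allTrue (upperPairs n))) (trans (ones-upperPairs {n} (λ _ → true))
  (trans (cong sum (map-cong (λ i → cong sum (map-cong (λ j → cong indicator (∧-identityʳ _)) (allFin n))) (allFin n)))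
         (upperCount≡C2 n)))

edgeBits : ∀ {n} → Mat n → List Bool
edgeBits {n} A = map (λ q → adj A (proj₁ q) (proj₂ q)) (upperPairs n)

edgeCount≡ones : ∀ {n} (A : Mat n) → edgeCount A ≡ ones (edgeBits A)
edgeCount≡ones {n} A = sym (ones-upperPairs {n} (λ q → adj A (proj₁ q) (proj₂ q)))

length-edgeBits : ∀ {n} (A : Mat n) → length (edgeBits A) ≡ n C 2
length-edgeBits {n} A = trans (length-map _ (upperPairs n)) (length-upperPairs n)

-- (3) Adding an edge

eqF : ∀ {n} → Fin n → Fin n → Bool
eqF i j = does (i F.≟ j)

eqF-refl : ∀ {n} (i : Fin n) → eqF i i ≡ true
eqF-refl i with i F.≟ i
... | yes _ = refl
... | no ¬p = ⊥-elim (¬p refl)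

addEdgeAdj : ∀ {n} → Mat n → Pair n → Fin n → Fin n → Bool
addEdgeAdj A (a , b) i j = adj A i j ∨ (eqF i a ∧ eqF j b) ∨ (eqF i b ∧ eqF j a)

addEdge : ∀ {n} → Mat n → Pair n → Mat n
addEdge A e = tabulate (λ i → tabulate (λ j → addEdgeAdj A e i j))

adj-addEdge : ∀ {n} (A : Mat n) e i j → adj (addEdge A e) i j ≡ addEdgeAdj A e i j
adj-addEdge A e i j =
  trans (cong (λ r → lookup r j) (lookup∘tabulate (λ i → tabulate (λ j → addEdgeAdj A e i j)) i))
        (lookup∘tabulate (λ j → addEdgeAdj A e i j) j)

Sub-addEdge : ∀ {n} (A : Mat n) e → Sub A (addEdge A e)
Sub-addEdge A e i j p rewrite adj-addEdge A e i j | p = refl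

addEdge-simple : ∀ {n} (A : Mat n) a b → IsSimple A → toℕ a < toℕ b → IsSimple (addEdge A (a , b))
addEdge-simple A a b (symmetric , loopless) a<b = symmetric′ , loopless′
  where
  swap-disjuncts : ∀ p x y z w → p ∨ (x ∧ y) ∨ (z ∧ w) ≡ p ∨ (w ∧ z) ∨ (y ∧ x)
  swap-disjuncts p x y z w =
    trans (cong₂ (λ u v → p ∨ u ∨ v) (∧-comm x y) (∧-comm z w)) (cong (p ∨_) (∨-comm (y ∧ x) (w ∧ z)))
  notBoth : ∀ i → eqF i a ∧ eqF i b ≡ false
  notBoth i with i F.≟ a | i F.≟ b
  ... | yes refl | yes refl = ⊥-elim (<-irrefl refl a<b)
  ... | yes _ | no _ = refl
  ... | no _ | _ = refl
  symmetric′ : ∀ i j → adj (addEdge A (a , b)) i j ≡ adj (addEdge A (a , b)) j i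
  symmetric′ i j rewrite adj-addEdge A (a , b) i j | adj-addEdge A (a , b) j i | symmetric i j =
    swap-disjuncts (adj A j i) (eqF i a) (eqF j b) (eqF i b) (eqF j a)
  loopless′ : ∀ i → adj (addEdge A (a , b)) i i ≡ false
  loopless′ i rewrite adj-addEdge A (a , b) i i | loopless i | notBoth i
    | ∧-comm (eqF i b) (eqF i a) | notBoth i = refl

eqF-notPair : ∀ {n} (i j a b : Fin n) → ¬ (i ≡ a × j ≡ b) → eqF i a ∧ eqF j b ≡ false
eqF-notPair i j a b ne with i F.≟ a | j F.≟ b
... | yes p | yes q = ⊥-elim (ne (p , q))
... | yes _ | no _ = refl
... | no _ | _ = refl

addEdge-elsewhere : ∀ {n} (A : Mat n) a b i j → toℕ a < toℕ b → toℕ i < toℕ j → (i , j) ≢ (a , b) →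
  adj (addEdge A (a , b)) i j ≡ adj A i j
addEdge-elsewhere A a b i j a<b i<j ne rewrite adj-addEdge A (a , b) i j
  | eqF-notPair i j a b (λ { (refl , refl) → ne refl })
  | eqF-notPair i j b a (λ { (refl , refl) → <-asym a<b i<j }) = ∨-identityʳ (adj A i j)

addEdge-at : ∀ {n} (A : Mat n) a b → adj (addEdge A (a , b)) a b ≡ true
addEdge-at A a b rewrite adj-addEdge A (a , b) a b | eqF-refl a | eqF-refl b = ∨-zeroʳ (adj A a b)

Reachable-mono : ∀ {n} {A B : Mat n} → Sub A B → ∀ {u v} → Reachable A u v → Reachable B u v
Reachable-mono s here = here
Reachable-mono s (step {u} {w} e r) = step (s u w e) (Reachable-mono s r)

vec-ext : ∀ {X : Set} {n} (u v : Vec X n) → (∀ i → lookup u i ≡ lookup v i) → u ≡ v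
vec-ext u v p = trans (sym (tabulate∘lookup u)) (trans (tabulate-cong p) (tabulate∘lookup v))

simple-ext : ∀ {n} (A B : Mat n) → IsSimple A → IsSimple B →
  (∀ i j → toℕ i < toℕ j → adj A i j ≡ adj B i j) → A ≡ B
simple-ext A B (symA , loopA) (symB , loopB) upper = vec-ext A B (λ i → vec-ext _ _ (λ j → entry i j))
  where
  entry : ∀ i j → adj A i j ≡ adj B i j
  entry i j with <-cmp (toℕ i) (toℕ j)
  ... | tri< lt _ _ = upper i j lt
  ... | tri> _ _ gt = trans (symA i j) (trans (upper j i gt) (sym (symB i j)))
  ... | tri≈ _ eq _ with toℕ-injective eq
  ...   | refl = trans (loopA i) (sym (loopB i))

edgeBits-injective : ∀ {n} (A B : Mat n) → IsSimple A → IsSimple B → edgeBits A ≡ edgeBits B → A ≡ B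
edgeBits-injective {n} A B sA sB eq = simple-ext A B sA sB λ i j lt →
  map-agree (λ q → adj A (proj₁ q) (proj₂ q)) (λ q → adj B (proj₁ q) (proj₂ q))
            (upperPairs n) eq (upperPairs-complete n i j lt)

-- The edge to be added: the upper pair at the first unmatched "(" of the
-- edge string (d is a default pair, never used below the middle level).
freeEdge : ∀ {n} → Pair n → Mat n → Pair n
freeEdge {n} d A = nthOr (upperPairs n) (firstFreeOpen 0 (edgeBits A)) d

raise : ∀ {n} → Pair n → Mat n → Mat n
raise d A = addEdge A (freeEdge d A)

firstFreeOpen<pairs : ∀ {n} (A : Mat n) → hasFreeOpen 0 (edgeBits A) ≡ true →
  firstFreeOpen 0 (edgeBits A) < length (upperPairs n)
firstFreeOpen<pairs {n} A p =
  subst (firstFreeOpen 0 (edgeBits A) <_) (length-map _ (upperPairs n)) (firstFreeOpen<length 0 (edgeBits A) p)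

freeEdge∈upperPairs : ∀ {n} (d : Pair n) (A : Mat n) → hasFreeOpen 0 (edgeBits A) ≡ true →
  freeEdge d A ∈ upperPairs n
freeEdge∈upperPairs {n} d A p = nthOr∈ (upperPairs n) (firstFreeOpen 0 (edgeBits A)) d (firstFreeOpen<pairs A p)

edgeBits-raise : ∀ {n} (d : Pair n) (A : Mat n) → hasFreeOpen 0 (edgeBits A) ≡ true →
  edgeBits (raise d A) ≡ setAt (edgeBits A) (firstFreeOpen 0 (edgeBits A))
edgeBits-raise {n} d A p =
  map-setAt (λ q → adj A (proj₁ q) (proj₂ q)) (λ q → adj (raise d A) (proj₁ q) (proj₂ q))
    (upperPairs n) (firstFreeOpen 0 (edgeBits A)) d (upperPairs-unique n) (firstFreeOpen<pairs A p)
    elsewhere (addEdge-at A (proj₁ e) (proj₂ e))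
  where
  e = freeEdge d A
  elsewhere : ∀ q → q ∈ upperPairs n → q ≢ e → adj (raise d A) (proj₁ q) (proj₂ q) ≡ adj A (proj₁ q) (proj₂ q)
  elsewhere q q∈ ne = addEdge-elsewhere A (proj₁ e) (proj₂ e) (proj₁ q) (proj₂ q)
    (upperPairs-upper n (freeEdge∈upperPairs d A p)) (upperPairs-upper n q∈) ne

hasFreeOpen-edgeBits : ∀ n k (A : Mat n) → suc (k + k) ≤ n C 2 → edgeCount A ≡ k →
  hasFreeOpen 0 (edgeBits A) ≡ true
hasFreeOpen-edgeBits n k A bound ec = hasFreeOpen-belowMiddle (edgeBits A)
  (subst (_< zeros (edgeBits A)) (sym onesA) (+-cancelˡ-< k k (zeros (edgeBits A)) (subst (suc (k + k) ≤_) (sym total) bound)))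
  where
  onesA : ones (edgeBits A) ≡ k
  onesA = trans (sym (edgeCount≡ones A)) ec
  total : k + zeros (edgeBits A) ≡ n C 2
  total = trans (cong (_+ zeros (edgeBits A)) (sym onesA)) (trans (ones+zeros≡length (edgeBits A)) (length-edgeBits A))

raise-InG : ∀ n (d : Pair n) k → suc (k + k) ≤ n C 2 → ∀ G → InG n k G → InG n (suc k) (raise d G)
raise-InG n d k bound G (simple , connected , ec) =
    addEdge-simple G (proj₁ e) (proj₂ e) simple (upperPairs-upper n (freeEdge∈upperPairs d G free))
  , (λ u v → Reachable-mono (Sub-addEdge G e) (connected u v))
  , (begin
      edgeCount (raise d G)                       ≡⟨ edgeCount≡ones (raise d G) ⟩
      ones (edgeBits (raise d G))                 ≡⟨ cong ones (edgeBits-raise d G free) ⟩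
      ones (setAt (edgeBits G) (firstFreeOpen 0 (edgeBits G))) ≡⟨ ones-flip 0 (edgeBits G) free ⟩
      suc (ones (edgeBits G))                     ≡⟨ cong suc (trans (sym (edgeCount≡ones G)) ec) ⟩
      suc k                                       ∎)
  where
  open ≡-Reasoning
  free = hasFreeOpen-edgeBits n k G bound ec
  e = freeEdge d G

raise-injective : ∀ n (d : Pair n) k → suc (k + k) ≤ n C 2 →
  ∀ G H → InG n k G → InG n k H → raise d G ≡ raise d H → G ≡ H
raise-injective n d k bound G H (simpleG , _ , ecG) (simpleH , _ , ecH) eq =
  edgeBits-injective G H simpleG simpleH (begin
    edgeBits G                                                        ≡⟨ sym (reopen-flip 0 (edgeBits G) freeG) ⟩
    reopenLastFreeClose 0 (setAt (edgeBits G) (firstFreeOpen 0 (edgeBits G))) ≡⟨ cong (reopenLastFreeClose 0) flipsAgree ⟩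
    reopenLastFreeClose 0 (setAt (edgeBits H) (firstFreeOpen 0 (edgeBits H))) ≡⟨ reopen-flip 0 (edgeBits H) freeH ⟩
    edgeBits H                                                        ∎)
  where
  open ≡-Reasoning
  freeG = hasFreeOpen-edgeBits n k G bound ecG
  freeH = hasFreeOpen-edgeBits n k H bound ecH
  flipsAgree = trans (sym (edgeBits-raise d G freeG)) (trans (cong edgeBits eq) (edgeBits-raise d H freeH))

belowMiddle : ∀ m k → suc k ≤ ⌈ m /2⌉ → suc (k + k) ≤ m
belowMiddle (suc zero) zero _ = s≤s z≤n
belowMiddle (suc zero) (suc k) (s≤s ())
belowMiddle (suc (suc m)) zero _ = s≤s z≤n
belowMiddle (suc (suc m)) (suc k) (s≤s h) rewrite +-suc k k = s≤s (s≤s (belowMiddle m k h))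

raiseMatching : ∀ n (d : Pair n) k → suc (k + k) ≤ n C 2 → CompleteMatching n k (suc k)
raiseMatching n d k bound = record
  { f       = raise d
  ; maps-to = raise-InG n d k bound
  ; injOn   = raise-injective n d k bound
  ; compar  = λ G _ → inj₁ (Sub-addEdge G (freeEdge d G))
  }

lemma3p2 : (n : ℕ) → 1 ≤ n → (k : ℕ) → n ∸ 1 ≤ k → suc k ≤ ⌈ (n C 2) /2⌉ →
    CompleteMatching n k (suc k)
lemma3p2 (suc n) _ k _ h = raiseMatching (suc n) (F.zero , F.zero) k (belowMiddle (suc n C 2) k h)
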